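{- Let $k\ge2$ and $n_1,\dots,n_k\ge2$ be integers. Then $\Gamma(\mathbb{Z}_{n_1}\times\cdots\times\mathbb{Z}_{n_k})$ is chordal if and only if, up to reordering of the factors, the ring is $\mathbb{Z}_2\times\mathbb{Z}_p$ or $\mathbb{Z}_2\times\mathbb{Z}_{p^2}$ for some prime $p$, or $\mathbb{Z}_2\times\mathbb{Z}_2\times\mathbb{Z}_2$.
   Context: For a commutative ring $R$ with identity, the zero-divisor graph $\Gamma(R)$ is the simple undirected graph whose vertices are the nonzero zero-divisors of $R$, two distinct vertices $u,v$ being adjacent iff $uv=0$. A graph is chordal if every cycle of length greater than $3$ has a chord. -}

module Defs where

open import Data.Nat using (ℕ; zero; suc; _*_; _≤_; _%_)
open import Data.Nat.Divisibility using (_∣_)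
open import Data.Nat.DivMod using (m%n<n)
open import Data.Nat.Primality using (Prime)
open import Data.Fin using (Fin; toℕ; fromℕ<)
open import Data.Product using (Σ; _×_; ∃)
open import Data.Sum using (_⊎_)
open import Data.Empty using (⊥)
open import Relation.Binary.PropositionalEquality using (_≡_; _≢_)
open import Relation.Nullary using (¬_)

Elem : (k : ℕ) → (Fin k → ℕ) → Set
Elem k n = (i : Fin k) → Fin (n i)

module _ {k : ℕ} {n : Fin k → ℕ} where

  _≈_ : Elem k n → Elem k n → Set
  x ≈ y = ∀ i → x i ≡ y i

  IsZero : Elem k n → Set
  IsZero x = ∀ i → toℕ (x i) ≡ 0

  MulZero : Elem k n → Elem k n → Set
  MulZero x y = ∀ i → n i ∣ (toℕ (x i) * toℕ (y i))

  IsVertex : Elem k n → Set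
  IsVertex x = ¬ IsZero x × ∃ λ y → ¬ IsZero y × MulZero x y

  Adj : Elem k n → Elem k n → Set
  Adj x y = ¬ (x ≈ y) × MulZero x y

next : ∀ {m} → Fin (suc m) → Fin (suc m)
next {m} i = fromℕ< (m%n<n (suc (toℕ i)) (suc m))

record Cycle {k : ℕ} (n : Fin k → ℕ) (m : ℕ) : Set where
  field
    v        : Fin (suc m) → Elem k n
    vertex   : ∀ i → IsVertex (v i)
    distinct : ∀ i j → i ≢ j → ¬ (v i ≈ v j)
    edges    : ∀ i → Adj (v i) (v (next i))

HasChord : ∀ {k} {n : Fin k → ℕ} {m} → Cycle n m → Set
HasChord {m = m} C = Σ (Fin (suc m)) λ i → Σ (Fin (suc m)) λ j →
  i ≢ j × j ≢ next i × i ≢ next j × Adj (Cycle.v C i) (Cycle.v C j)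

Chordal : (k : ℕ) → (Fin k → ℕ) → Set
Chordal k n = ∀ m → 4 ≤ suc m → (C : Cycle n m) → HasChord C

ListedRing : (k : ℕ) → (Fin k → ℕ) → Set
ListedRing 2 n = Σ ℕ λ p → Prime p ×
  ((n Fin.zero ≡ 2 × (n (Fin.suc Fin.zero) ≡ p ⊎ n (Fin.suc Fin.zero) ≡ p * p))
   ⊎ (n (Fin.suc Fin.zero) ≡ 2 × (n Fin.zero ≡ p ⊎ n Fin.zero ≡ p * p)))
  where import Data.Fin as Fin
ListedRing 3 n = ∀ i → n i ≡ 2
ListedRing _ n = ⊥

-- If the nonzero elements of a ring split into a clique K and an independent set I of Γ,
-- then every cycle of length at least four has a chord: look at its vertices in positions
-- 1 and 3; if one of them lies in I, its two cycle neighbours lie in K and are joined,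
-- otherwise both lie in K and are joined.  Such splittings exist for ℤ₂ × ℤ_p and
-- ℤ₂ × ℤ_{p²} (K consists of (1,0) and the (0, pt)) and for ℤ₂³ (K consists of the unit
-- vectors).
--
-- Every other ring contains a chordless square x₀ x₁ x₂ x₃: xᵢ xᵢ₊₁ = 0 but
-- x₀ x₂ ≠ 0 ≠ x₁ x₃.  It is built one coordinate at a time: e₀, e₁, e₀ + e₂, e₁ + e₃ for
-- four or more factors; eᵢ, 1 − eᵢ, 2eᵢ, eⱼ for three factors with nᵢ ≥ 3; e₀, e₁, 2e₀, 2e₁
-- in ℤ_a × ℤ_b with a, b ≥ 3; and (1,0), (0,s), (1,1+r), (0,rs) in ℤ_a × ℤ_m when
-- m = s(1+r) with 1+r ∤ s, which is how an m ≥ 2 that is neither a prime nor a prime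
-- square factors.

module Submission where

open import Defs
open import Data.Nat
  using (ℕ; zero; suc; _+_; _*_; _≤_; _<_; _%_; _/_; z≤n; s≤s; z<s; NonZero; >-nonZero; nonTrivial⇒n>1; _≟_)
open import Data.Nat.Properties
open import Data.Nat.DivMod using (m≡m%n+[m/n]*n; m%n%n≡m%n; %-distribˡ-+; m<n⇒m%n≡m)
open import Data.Nat.Divisibility
open import Data.Nat.Primality
  using (Prime; euclidsLemma; prime⇒nonZero; prime⇒nonTrivial; prime⇒irreducible)
open import Data.Nat.Primality.Factorisation using (factorise)
open import Data.Nat.Tactic.RingSolver using (solve-∀)
open import Data.Fin using (Fin; toℕ; fromℕ<; opposite)
import Data.Fin as Fin
open import Data.Fin.Patterns using (0F; 1F; 2F; 3F)
open import Data.Fin.Properties using (toℕ-fromℕ<; toℕ-injective; toℕ<n)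
open import Data.List using ([]; _∷_)
open import Data.Nat.ListAction using (product)
open import Data.List.Relation.Unary.All using (_∷_)
open import Data.Product using (_×_; ∃; _,_; proj₁; proj₂)
open import Data.Sum using (_⊎_; inj₁; inj₂; [_,_]′)
open import Data.Empty using (⊥-elim)
open import Function using (_∘_)
open import Function.Bundles using (_⇔_; mk⇔)
open import Relation.Binary.PropositionalEquality
open import Relation.Nullary using (¬_; yes; no)

-- Walking around a cycle

next^ : ∀ {m} → ℕ → Fin (suc m) → Fin (suc m)
next^ zero    i = i
next^ (suc d) i = next (next^ d i)

suc-%-% : ∀ a M .{{_ : NonZero M}} → suc (a % M) % M ≡ suc a % M
suc-%-% a M = begin
  (1 + a % M) % M          ≡⟨ %-distribˡ-+ 1 (a % M) M ⟩
  (1 % M + a % M % M) % M  ≡⟨ cong (λ t → (1 % M + t) % M) (m%n%n≡m%n a M) ⟩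
  (1 % M + a % M) % M      ≡⟨ %-distribˡ-+ 1 a M ⟨
  (1 + a) % M              ∎
  where open ≡-Reasoning

toℕ-next^ : ∀ {m} d (i : Fin (suc m)) → toℕ (next^ d i) ≡ (d + toℕ i) % suc m
toℕ-next^ zero i = sym (m<n⇒m%n≡m (toℕ<n i))
toℕ-next^ {m} (suc d) i = begin
  toℕ (next (next^ d i))             ≡⟨ toℕ-fromℕ< _ ⟩
  suc (toℕ (next^ d i)) % suc m      ≡⟨ cong (λ t → suc t % suc m) (toℕ-next^ d i) ⟩
  suc ((d + toℕ i) % suc m) % suc m  ≡⟨ suc-%-% (d + toℕ i) (suc m) ⟩
  suc (d + toℕ i) % suc m            ∎
  where open ≡-Reasoning

-- Returning to i after d steps would make the cycle length divide d.
next^-≢ : ∀ {m d} → 0 < d → d < suc m → (i : Fin (suc m)) → next^ d i ≢ i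
next^-≢ {m} {d} 0<d d<1+m i next^ᵈi≡i =
  <⇒≱ d<1+m (∣⇒≤ {{>-nonZero 0<d}} (divides q (+-cancelʳ-≡ t d (q * suc m) d+t≡q*[1+m]+t)))
  where
  t = toℕ i
  q = (d + t) / suc m
  d+t≡q*[1+m]+t : d + t ≡ q * suc m + t
  d+t≡q*[1+m]+t = begin
    d + t                        ≡⟨ m≡m%n+[m/n]*n (d + t) (suc m) ⟩
    (d + t) % suc m + q * suc m  ≡⟨ cong (_+ q * suc m) (trans (sym (toℕ-next^ d i)) (cong toℕ next^ᵈi≡i)) ⟩
    t + q * suc m                ≡⟨ +-comm t (q * suc m) ⟩
    q * suc m + t                ∎
    where open ≡-Reasoning

-- Zero divisors coordinatewise

zeroˡ⇒∣* : ∀ {N u w} → u ≡ 0 → N ∣ u * w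
zeroˡ⇒∣* {N} refl = N ∣0

zeroʳ⇒∣* : ∀ {N} u {w} → w ≡ 0 → N ∣ u * w
zeroʳ⇒∣* {N} u refl = subst (N ∣_) (sym (*-zeroʳ u)) (N ∣0)

∣∧<⇒≡0 : ∀ {N v} → N ∣ v → v < N → v ≡ 0
∣∧<⇒≡0 {v = zero}  _   _   = refl
∣∧<⇒≡0 {v = suc _} N∣v v<N = ⊥-elim (>⇒∤ v<N N∣v)

∤1*1 : ∀ {N u w} → N ≡ 2 → u ≡ 1 → w ≡ 1 → ¬ N ∣ u * w
∤1*1 refl refl refl = >⇒∤ ≤-refl

toℕ-bit : ∀ {N} → N ≡ 2 → (a : Fin N) → toℕ a ≡ 0 ⊎ toℕ a ≡ 1
toℕ-bit refl 0F = inj₁ refl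
toℕ-bit refl 1F = inj₂ refl

pointwise₂ : {P : Fin 2 → Set} → P 0F → P 1F → ∀ i → P i
pointwise₂ P₀ P₁ 0F = P₀
pointwise₂ P₀ P₁ 1F = P₁

pointwise₃ : {P : Fin 3 → Set} → P 0F → P 1F → P 2F → ∀ i → P i
pointwise₃ P₀ P₁ P₂ 0F = P₀
pointwise₃ P₀ P₁ P₂ 1F = P₁
pointwise₃ P₀ P₁ P₂ 2F = P₂

module _ {k : ℕ} {n : Fin k → ℕ} where

  ≈-sym : {x y : Elem k n} → x ≈ y → y ≈ x
  ≈-sym x≈y i = sym (x≈y i)

  mulZero-sym : {x y : Elem k n} → MulZero x y → MulZero y x
  mulZero-sym {x} {y} xy≡0 i = subst (n i ∣_) (*-comm (toℕ (x i)) (toℕ (y i))) (xy≡0 i)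

  mulZero-respˡ-≈ : {x y z : Elem k n} → x ≈ y → MulZero x z → MulZero y z
  mulZero-respˡ-≈ {z = z} x≈y xz≡0 i = subst (λ a → n i ∣ toℕ a * toℕ (z i)) (x≈y i) (xz≡0 i)

  disjoint⇒mulZero : (x y : Elem k n) → (∀ i → toℕ (x i) ≡ 0 ⊎ toℕ (y i) ≡ 0) → MulZero x y
  disjoint⇒mulZero x y disjoint i = [ zeroˡ⇒∣* , zeroʳ⇒∣* (toℕ (x i)) ]′ (disjoint i)

  isZero⇒mulZero : {x y : Elem k n} → IsZero x → MulZero x y
  isZero⇒mulZero {x} {y} x≡0 = disjoint⇒mulZero x y (inj₁ ∘ x≡0)

  chordal-reindex : (σ : Fin k → Fin k) → (∀ j → ∃ λ i → σ i ≡ j) → Chordal k (n ∘ σ) → Chordal k n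
  chordal-reindex σ σ-surjective chordal m 4≤1+m C = chord (chordal m 4≤1+m C∘σ)
    where
    open Cycle C
    everywhere : {P : Fin k → Set} → (∀ i → P (σ i)) → ∀ j → P j
    everywhere Pσ j with i , refl ← σ-surjective j = Pσ i
    C∘σ : Cycle (n ∘ σ) m
    C∘σ = record
      { v        = λ i → v i ∘ σ
      ; vertex   = λ i → let (vᵢ≢0 , y , y≢0 , vᵢy≡0) = vertex i
                         in vᵢ≢0 ∘ everywhere , y ∘ σ , y≢0 ∘ everywhere , vᵢy≡0 ∘ σ
      ; distinct = λ i j i≢j vᵢ≈vⱼ → distinct i j i≢j (everywhere vᵢ≈vⱼ)
      ; edges    = λ i → let (vᵢ≉v₊ , vᵢv₊≡0) = edges i
                         in vᵢ≉v₊ ∘ everywhere , vᵢv₊≡0 ∘ σ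
      }
    chord : HasChord C∘σ → HasChord C
    chord (i , j , i≢j , j≢next-i , i≢next-j , vᵢσ≉vⱼσ , vᵢσvⱼσ≡0) =
      i , j , i≢j , j≢next-i , i≢next-j , (vᵢσ≉vⱼσ ∘ _∘ σ) , everywhere vᵢσvⱼσ≡0

  splitGraph⇒chordal : (K I : Elem k n → Set) →
    (∀ x → ¬ IsZero x → K x ⊎ I x) →
    (∀ x y → K x → K y → ¬ x ≈ y → MulZero x y) →
    (∀ x y → I x → I y → ¬ MulZero x y) →
    Chordal k n
  splitGraph⇒chordal K I split clique independent m (s≤s 3≤m) C = chord
    where
    open Cycle C
    side : ∀ i → K (v i) ⊎ I (v i)
    side i = split (v i) (proj₁ (vertex i))
    K-neighbour : ∀ {i j} → I (v j) → MulZero (v i) (v j) → K (v i)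
    K-neighbour {i} Iⱼ vᵢvⱼ≡0 with side i
    ... | inj₁ Kᵢ = Kᵢ
    ... | inj₂ Iᵢ = ⊥-elim (independent _ _ Iᵢ Iⱼ vᵢvⱼ≡0)
    K-before : ∀ i → I (v (next i)) → K (v i)
    K-before i I₊ = K-neighbour I₊ (proj₂ (edges i))
    K-after : ∀ i → I (v i) → K (v (next i))
    K-after i Iᵢ = K-neighbour Iᵢ (mulZero-sym {x = v i} (proj₂ (edges i)))
    next^≤3-≢ : ∀ d → 0 < d → d ≤ 3 → ∀ i → next^ d i ≢ i
    next^≤3-≢ d 0<d d≤3 = next^-≢ 0<d (s≤s (≤-trans d≤3 3≤m))
    chord-over : ∀ i → K (v i) → K (v (next (next i))) → HasChord C
    chord-over i Kᵢ K₊₂ =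
      i , next (next i) , i≢i₊₂ , next^≤3-≢ 1 z<s (s≤s z≤n) (next i) ,
      ≢-sym (next^≤3-≢ 3 z<s ≤-refl i) , distinct _ _ i≢i₊₂ , clique _ _ Kᵢ K₊₂ (distinct _ _ i≢i₊₂)
      where
      i≢i₊₂ = ≢-sym (next^≤3-≢ 2 z<s (s≤s (s≤s z≤n)) i)
    chord : HasChord C
    chord with side (next 0F)
    ... | inj₂ I₁ = chord-over 0F (K-before 0F I₁) (K-after (next 0F) I₁)
    ... | inj₁ K₁ with side (next^ 3 0F)
    ...   | inj₁ K₃ = chord-over (next 0F) K₁ K₃
    ...   | inj₂ I₃ = chord-over (next^ 2 0F) (K-before _ I₃) (K-after _ I₃)

-- Rings whose zero-divisor graph splits into a clique and an independent set

prime-cancel : ∀ {p u v} → Prime p → ¬ p ∣ u → p ∣ u * v → p ∣ v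
prime-cancel {u = u} {v} p-prime p∤u p∣uv with euclidsLemma u v p-prime p∣uv
... | inj₁ p∣u = ⊥-elim (p∤u p∣u)
... | inj₂ p∣v = p∣v

primeSquare-cancel : ∀ {p u v} → Prime p → ¬ p ∣ u → p * p ∣ u * v → p * p ∣ v
primeSquare-cancel {p} {u} p-prime p∤u p²∣uv with prime-cancel p-prime p∤u (∣-trans (m∣m*n p) p²∣uv)
... | divides w refl = *-monoˡ-∣ p (prime-cancel p-prime p∤u p∣uw)
  where
  p∣uw : p ∣ u * w
  p∣uw = *-cancelʳ-∣ p {{prime⇒nonZero p-prime}} (subst (p * p ∣_) (sym (*-assoc u w p)) p²∣uv)

primeOrPrimeSquare-cancel : ∀ {p N u v} → Prime p → N ≡ p ⊎ N ≡ p * p → ¬ p ∣ u → N ∣ u * v → N ∣ v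
primeOrPrimeSquare-cancel p-prime (inj₁ refl) = prime-cancel p-prime
primeOrPrimeSquare-cancel p-prime (inj₂ refl) = primeSquare-cancel p-prime

chordal-ℤ₂×ℤₚᵉ : ∀ {n : Fin 2 → ℕ} {p} → Prime p → n 0F ≡ 2 → n 1F ≡ p ⊎ n 1F ≡ p * p → Chordal 2 n
chordal-ℤ₂×ℤₚᵉ {n} {p} p-prime n₀≡2 n₁≡pᵉ = splitGraph⇒chordal K I split clique independent
  where
  K I : Elem 2 n → Set
  K x = (toℕ (x 0F) ≡ 1 × toℕ (x 1F) ≡ 0) ⊎ (toℕ (x 0F) ≡ 0 × p ∣ toℕ (x 1F))
  I x = (toℕ (x 0F) ≡ 0 × ¬ p ∣ toℕ (x 1F)) ⊎ (toℕ (x 0F) ≡ 1 × toℕ (x 1F) ≢ 0)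

  split : ∀ x → ¬ IsZero x → K x ⊎ I x
  split x _ with toℕ-bit n₀≡2 (x 0F) | p ∣? toℕ (x 1F) | toℕ (x 1F) ≟ 0
  ... | inj₁ x₀≡0 | yes p∣x₁ | _        = inj₁ (inj₂ (x₀≡0 , p∣x₁))
  ... | inj₁ x₀≡0 | no p∤x₁  | _        = inj₂ (inj₁ (x₀≡0 , p∤x₁))
  ... | inj₂ x₀≡1 | _        | yes x₁≡0 = inj₁ (inj₁ (x₀≡1 , x₁≡0))
  ... | inj₂ x₀≡1 | _        | no x₁≢0  = inj₂ (inj₂ (x₀≡1 , x₁≢0))

  n₁∣p² : n 1F ∣ p * p
  n₁∣p² = [ (λ n₁≡p → subst (_∣ p * p) (sym n₁≡p) (m∣m*n p)) , ∣-reflexive ]′ n₁≡pᵉ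

  clique : ∀ x y → K x → K y → ¬ x ≈ y → MulZero x y
  clique x y (inj₁ (x₀≡1 , x₁≡0)) (inj₁ (y₀≡1 , y₁≡0)) x≉y =
    ⊥-elim (x≉y (pointwise₂ (toℕ-injective (trans x₀≡1 (sym y₀≡1)))
                            (toℕ-injective (trans x₁≡0 (sym y₁≡0)))))
  clique x y (inj₁ (_ , x₁≡0)) (inj₂ (y₀≡0 , _)) _ =
    disjoint⇒mulZero x y (pointwise₂ (inj₂ y₀≡0) (inj₁ x₁≡0))
  clique x y (inj₂ (x₀≡0 , _)) (inj₁ (_ , y₁≡0)) _ =
    disjoint⇒mulZero x y (pointwise₂ (inj₁ x₀≡0) (inj₂ y₁≡0))
  clique x y (inj₂ (x₀≡0 , p∣x₁)) (inj₂ (_ , p∣y₁)) _ =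
    pointwise₂ (zeroˡ⇒∣* x₀≡0) (∣-trans n₁∣p² (*-pres-∣ p∣x₁ p∣y₁))

  I⇒≢0 : ∀ {y} → I y → toℕ (y 1F) ≢ 0
  I⇒≢0 (inj₁ (_ , p∤y₁)) y₁≡0 = p∤y₁ (subst (p ∣_) (sym y₁≡0) (p ∣0))
  I⇒≢0 (inj₂ (_ , y₁≢0))     = y₁≢0

  annihilated : ∀ x y → ¬ p ∣ toℕ (x 1F) → MulZero x y → toℕ (y 1F) ≡ 0
  annihilated x y p∤x₁ xy≡0 =
    ∣∧<⇒≡0 (primeOrPrimeSquare-cancel p-prime n₁≡pᵉ p∤x₁ (xy≡0 1F)) (toℕ<n (y 1F))

  independent : ∀ x y → I x → I y → ¬ MulZero x y
  independent x y (inj₁ (_ , p∤x₁)) Iy xy≡0 = I⇒≢0 {y} Iy (annihilated x y p∤x₁ xy≡0)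
  independent x y Ix@(inj₂ _) (inj₁ (_ , p∤y₁)) xy≡0 =
    I⇒≢0 {x} Ix (annihilated y x p∤y₁ (mulZero-sym {x = x} xy≡0))
  independent x y (inj₂ (x₀≡1 , _)) (inj₂ (y₀≡1 , _)) xy≡0 = ∤1*1 n₀≡2 x₀≡1 y₀≡1 (xy≡0 0F)

chordal-ℤ₂³ : ∀ {n : Fin 3 → ℕ} → (∀ i → n i ≡ 2) → Chordal 3 n
chordal-ℤ₂³ {n} n≡2 = splitGraph⇒chordal K I split clique independent
  where
  Bits : Elem 3 n → ℕ → ℕ → ℕ → Set
  Bits x a b c = toℕ (x 0F) ≡ a × toℕ (x 1F) ≡ b × toℕ (x 2F) ≡ c

  K I : Elem 3 n → Set
  K x = Bits x 1 0 0 ⊎ Bits x 0 1 0 ⊎ Bits x 0 0 1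
  I x = (toℕ (x 0F) ≡ 1 × toℕ (x 1F) ≡ 1) ⊎ (toℕ (x 0F) ≡ 1 × toℕ (x 2F) ≡ 1)
      ⊎ (toℕ (x 1F) ≡ 1 × toℕ (x 2F) ≡ 1)

  split : ∀ x → ¬ IsZero x → K x ⊎ I x
  split x x≢0 with toℕ-bit (n≡2 0F) (x 0F) | toℕ-bit (n≡2 1F) (x 1F) | toℕ-bit (n≡2 2F) (x 2F)
  ... | inj₁ x₀ | inj₁ x₁ | inj₁ x₂ = ⊥-elim (x≢0 (pointwise₃ x₀ x₁ x₂))
  ... | inj₂ x₀ | inj₁ x₁ | inj₁ x₂ = inj₁ (inj₁ (x₀ , x₁ , x₂))
  ... | inj₁ x₀ | inj₂ x₁ | inj₁ x₂ = inj₁ (inj₂ (inj₁ (x₀ , x₁ , x₂)))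
  ... | inj₁ x₀ | inj₁ x₁ | inj₂ x₂ = inj₁ (inj₂ (inj₂ (x₀ , x₁ , x₂)))
  ... | inj₂ x₀ | inj₂ x₁ | _       = inj₂ (inj₁ (x₀ , x₁))
  ... | inj₂ x₀ | inj₁ _  | inj₂ x₂ = inj₂ (inj₂ (inj₁ (x₀ , x₂)))
  ... | inj₁ _  | inj₂ x₁ | inj₂ x₂ = inj₂ (inj₂ (inj₂ (x₁ , x₂)))

  same-bits : ∀ {x y a b c} → Bits x a b c → Bits y a b c → x ≈ y
  same-bits (x₀ , x₁ , x₂) (y₀ , y₁ , y₂) =
    pointwise₃ (toℕ-injective (trans x₀ (sym y₀))) (toℕ-injective (trans x₁ (sym y₁)))
               (toℕ-injective (trans x₂ (sym y₂)))

  clique : ∀ x y → K x → K y → ¬ x ≈ y → MulZero x y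
  clique x y (inj₁ X) (inj₁ Y) x≉y = ⊥-elim (x≉y (same-bits X Y))
  clique x y (inj₂ (inj₁ X)) (inj₂ (inj₁ Y)) x≉y = ⊥-elim (x≉y (same-bits X Y))
  clique x y (inj₂ (inj₂ X)) (inj₂ (inj₂ Y)) x≉y = ⊥-elim (x≉y (same-bits X Y))
  clique x y (inj₁ (_ , x₁ , x₂)) (inj₂ (inj₁ (y₀ , _))) _ =
    disjoint⇒mulZero x y (pointwise₃ (inj₂ y₀) (inj₁ x₁) (inj₁ x₂))
  clique x y (inj₁ (_ , x₁ , x₂)) (inj₂ (inj₂ (y₀ , _))) _ =
    disjoint⇒mulZero x y (pointwise₃ (inj₂ y₀) (inj₁ x₁) (inj₁ x₂))
  clique x y (inj₂ (inj₁ (x₀ , _ , x₂))) (inj₁ (_ , y₁ , _)) _ =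
    disjoint⇒mulZero x y (pointwise₃ (inj₁ x₀) (inj₂ y₁) (inj₁ x₂))
  clique x y (inj₂ (inj₁ (x₀ , _ , x₂))) (inj₂ (inj₂ (_ , y₁ , _))) _ =
    disjoint⇒mulZero x y (pointwise₃ (inj₁ x₀) (inj₂ y₁) (inj₁ x₂))
  clique x y (inj₂ (inj₂ (x₀ , x₁ , _))) (inj₁ (_ , _ , y₂)) _ =
    disjoint⇒mulZero x y (pointwise₃ (inj₁ x₀) (inj₁ x₁) (inj₂ y₂))
  clique x y (inj₂ (inj₂ (x₀ , x₁ , _))) (inj₂ (inj₁ (_ , _ , y₂))) _ =
    disjoint⇒mulZero x y (pointwise₃ (inj₁ x₀) (inj₁ x₁) (inj₂ y₂))

  -- Two 2-element subsets of a 3-element set meet.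
  common-one : ∀ {x y} → I x → I y → ∃ λ c → toℕ (x c) ≡ 1 × toℕ (y c) ≡ 1
  common-one (inj₁ (x₀ , _))        (inj₁ (y₀ , _))        = 0F , x₀ , y₀
  common-one (inj₁ (x₀ , _))        (inj₂ (inj₁ (y₀ , _))) = 0F , x₀ , y₀
  common-one (inj₁ (_ , x₁))        (inj₂ (inj₂ (y₁ , _))) = 1F , x₁ , y₁
  common-one (inj₂ (inj₁ (x₀ , _))) (inj₁ (y₀ , _))        = 0F , x₀ , y₀
  common-one (inj₂ (inj₁ (x₀ , _))) (inj₂ (inj₁ (y₀ , _))) = 0F , x₀ , y₀
  common-one (inj₂ (inj₁ (_ , x₂))) (inj₂ (inj₂ (_ , y₂))) = 2F , x₂ , y₂
  common-one (inj₂ (inj₂ (x₁ , _))) (inj₁ (_ , y₁))        = 1F , x₁ , y₁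
  common-one (inj₂ (inj₂ (_ , x₂))) (inj₂ (inj₁ (_ , y₂))) = 2F , x₂ , y₂
  common-one (inj₂ (inj₂ (x₁ , _))) (inj₂ (inj₂ (y₁ , _))) = 1F , x₁ , y₁

  independent : ∀ x y → I x → I y → ¬ MulZero x y
  independent x y Ix Iy xy≡0 with c , xc≡1 , yc≡1 ← common-one {x} {y} Ix Iy =
    ∤1*1 (n≡2 c) xc≡1 yc≡1 (xy≡0 c)

-- Chordless squares

square-position : (i j : Fin 4) → j ≡ i ⊎ j ≡ next i ⊎ j ≡ next (next i) ⊎ i ≡ next j
square-position 0F 0F = inj₁ refl
square-position 0F 1F = inj₂ (inj₁ refl)
square-position 0F 2F = inj₂ (inj₂ (inj₁ refl))
square-position 0F 3F = inj₂ (inj₂ (inj₂ refl))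
square-position 1F 0F = inj₂ (inj₂ (inj₂ refl))
square-position 1F 1F = inj₁ refl
square-position 1F 2F = inj₂ (inj₁ refl)
square-position 1F 3F = inj₂ (inj₂ (inj₁ refl))
square-position 2F 0F = inj₂ (inj₂ (inj₁ refl))
square-position 2F 1F = inj₂ (inj₂ (inj₂ refl))
square-position 2F 2F = inj₁ refl
square-position 2F 3F = inj₂ (inj₁ refl)
square-position 3F 0F = inj₂ (inj₁ refl)
square-position 3F 1F = inj₂ (inj₂ (inj₁ refl))
square-position 3F 2F = inj₂ (inj₂ (inj₂ refl))
square-position 3F 3F = inj₁ refl

module _ {k : ℕ} {n : Fin k → ℕ} where

  chordlessSquare⇒¬chordal : (x : Fin 4 → Elem k n) →
    (∀ i → MulZero (x i) (x (next i))) →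
    ¬ MulZero (x 0F) (x 2F) → ¬ MulZero (x 1F) (x 3F) →
    ¬ x 0F ≈ x 2F → ¬ x 1F ≈ x 3F →
    ¬ Chordal k n
  chordlessSquare⇒¬chordal x edge ¬x₀x₂≡0 ¬x₁x₃≡0 x₀≉x₂ x₁≉x₃ chordal =
    chordless (chordal 3 ≤-refl square)
    where
    ¬diagonal : ∀ i → ¬ MulZero (x i) (x (next (next i)))
    ¬diagonal 0F = ¬x₀x₂≡0
    ¬diagonal 1F = ¬x₁x₃≡0
    ¬diagonal 2F = ¬x₀x₂≡0 ∘ mulZero-sym {x = x 2F}
    ¬diagonal 3F = ¬x₁x₃≡0 ∘ mulZero-sym {x = x 3F}
    ≉diagonal : ∀ i → ¬ x i ≈ x (next (next i))
    ≉diagonal 0F = x₀≉x₂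
    ≉diagonal 1F = x₁≉x₃
    ≉diagonal 2F = x₀≉x₂ ∘ ≈-sym
    ≉diagonal 3F = x₁≉x₃ ∘ ≈-sym
    -- Equal neighbours would have the same product with the next corner.
    ≉next : ∀ i → ¬ x i ≈ x (next i)
    ≉next i xᵢ≈x₊ = ¬diagonal i (mulZero-respˡ-≈ (≈-sym xᵢ≈x₊) (edge (next i)))
    ≢0 : ∀ i → ¬ IsZero (x i)
    ≢0 i xᵢ≡0 = ¬diagonal i (isZero⇒mulZero xᵢ≡0)
    distinct : ∀ i j → i ≢ j → ¬ x i ≈ x j
    distinct i j i≢j with square-position i j
    ... | inj₁ refl                = ⊥-elim (i≢j refl)
    ... | inj₂ (inj₁ refl)         = ≉next i
    ... | inj₂ (inj₂ (inj₁ refl))  = ≉diagonal i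
    ... | inj₂ (inj₂ (inj₂ refl))  = ≉next j ∘ ≈-sym
    square : Cycle n 3
    square = record
      { v        = x
      ; vertex   = λ i → ≢0 i , x (next i) , ≢0 (next i) , edge i
      ; distinct = distinct
      ; edges    = λ i → ≉next i , edge i
      }
    chordless : ¬ HasChord square
    chordless (i , j , i≢j , j≢next-i , i≢next-j , _ , xᵢxⱼ≡0) with square-position i j
    ... | inj₁ refl                = i≢j refl
    ... | inj₂ (inj₁ refl)         = j≢next-i refl
    ... | inj₂ (inj₂ (inj₁ refl))  = ¬diagonal i xᵢxⱼ≡0
    ... | inj₂ (inj₂ (inj₂ refl))  = i≢next-j refl

-- The values taken by one coordinate at the four corners of a square.
record Column (N : ℕ) : Set where
  field
    entry           : Fin 4 → ℕ
    entry<N         : ∀ i → entry i < N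
    annihilate-next : ∀ i → N ∣ entry i * entry (next i)

open Column

module _ {k : ℕ} {n : Fin k → ℕ} where

  columns⇒¬chordal : (col : (c : Fin k) → Column (n c)) →
    (∃ λ c → ¬ n c ∣ entry (col c) 0F * entry (col c) 2F) →
    (∃ λ c → ¬ n c ∣ entry (col c) 1F * entry (col c) 3F) →
    (∃ λ c → entry (col c) 0F ≢ entry (col c) 2F) →
    (∃ λ c → entry (col c) 1F ≢ entry (col c) 3F) →
    ¬ Chordal k n
  columns⇒¬chordal col (c₀₂ , ∤₀₂) (c₁₃ , ∤₁₃) (d₀₂ , ≢₀₂) (d₁₃ , ≢₁₃) =
    chordlessSquare⇒¬chordal corner
      (λ i c → subst (n c ∣_) (sym (toℕ-corner* i (next i) c)) (annihilate-next (col c) i))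
      (separated c₀₂ ∤₀₂) (separated c₁₃ ∤₁₃) (distinguished d₀₂ ≢₀₂) (distinguished d₁₃ ≢₁₃)
    where
    corner : Fin 4 → Elem k n
    corner i c = fromℕ< (entry<N (col c) i)
    toℕ-corner : ∀ i c → toℕ (corner i c) ≡ entry (col c) i
    toℕ-corner i c = toℕ-fromℕ< (entry<N (col c) i)
    toℕ-corner* : ∀ i j c → toℕ (corner i c) * toℕ (corner j c) ≡ entry (col c) i * entry (col c) j
    toℕ-corner* i j c = cong₂ _*_ (toℕ-corner i c) (toℕ-corner j c)
    separated : ∀ {i j} c → ¬ n c ∣ entry (col c) i * entry (col c) j → ¬ MulZero (corner i) (corner j)
    separated {i} {j} c ∤ᵢⱼ cᵢcⱼ≡0 = ∤ᵢⱼ (subst (n c ∣_) (toℕ-corner* i j c) (cᵢcⱼ≡0 c))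
    distinguished : ∀ {i j} c → entry (col c) i ≢ entry (col c) j → ¬ corner i ≈ corner j
    distinguished {i} {j} c ≢ᵢⱼ cᵢ≈cⱼ =
      ≢ᵢⱼ (trans (sym (toℕ-corner i c)) (trans (cong toℕ (cᵢ≈cⱼ c)) (toℕ-corner j c)))

evenColumn : ∀ {N a b} → a < N → b < N → Column N
evenColumn {N} {a} {b} a<N b<N = record
  { entry = entries ; entry<N = entries<N ; annihilate-next = annihilate }
  where
  entries : Fin 4 → ℕ
  entries 0F = a
  entries 1F = 0
  entries 2F = b
  entries 3F = 0
  entries<N : ∀ i → entries i < N
  entries<N 0F = a<N
  entries<N 1F = ≤-<-trans z≤n a<N
  entries<N 2F = b<N
  entries<N 3F = ≤-<-trans z≤n a<N
  annihilate : ∀ i → N ∣ entries i * entries (next i)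
  annihilate 0F = zeroʳ⇒∣* a refl
  annihilate 1F = N ∣0
  annihilate 2F = zeroʳ⇒∣* b refl
  annihilate 3F = N ∣0

rotate : ∀ {N} → Column N → Column N
rotate c = record
  { entry = entry c ∘ next ; entry<N = entry<N c ∘ next ; annihilate-next = annihilate-next c ∘ next }

-- the column (0, a, 0, b)
oddColumn : ∀ {N a b} → a < N → b < N → Column N
oddColumn a<N b<N = rotate (evenColumn b<N a<N)

-- A witness that m is neither a prime nor the square of a prime.
record SkewFactorisation (m : ℕ) : Set where
  field
    s r         : ℕ
    2≤s         : 2 ≤ s
    2≤r         : 2 ≤ r
    m≡s*[1+r]   : m ≡ s * suc r
    [1+r]∤s     : ¬ suc r ∣ s

module _ {m : ℕ} (f : SkewFactorisation m) where

  open SkewFactorisation f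

  private
    instance
      s≢0 : NonZero s
      s≢0 = >-nonZero (<-trans z<s 2≤s)

    r*[s*[1+r]]≡[1+r]*[r*s] : ∀ r s → r * (s * suc r) ≡ suc r * (r * s)
    r*[s*[1+r]]≡[1+r]*[r*s] = solve-∀

  skewColumn : Column m
  skewColumn = record { entry = entries ; entry<N = entries<m ; annihilate-next = annihilate }
    where
    entries : Fin 4 → ℕ
    entries 0F = 0
    entries 1F = s
    entries 2F = suc r
    entries 3F = r * s
    s<m : s < s * suc r
    s<m = m<m*n s (suc r) (s≤s (<⇒≤ 2≤r))
    entries<s[1+r] : ∀ i → entries i < s * suc r
    entries<s[1+r] 0F = ≤-<-trans z≤n s<m
    entries<s[1+r] 1F = s<m
    entries<s[1+r] 2F = subst (suc r <_) (*-comm (suc r) s) (m<m*n (suc r) s 2≤s)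
    entries<s[1+r] 3F = subst (r * s <_) (*-comm (suc r) s) (m<n+m (r * s) (<-trans z<s 2≤s))
    entries<m : ∀ i → entries i < m
    entries<m i = subst (entries i <_) (sym m≡s*[1+r]) (entries<s[1+r] i)
    annihilate : ∀ i → m ∣ entries i * entries (next i)
    annihilate 0F = m ∣0
    annihilate 1F = ∣-reflexive m≡s*[1+r]
    annihilate 2F = subst (_∣ suc r * (r * s)) (sym m≡s*[1+r])
      (subst (s * suc r ∣_) (r*[s*[1+r]]≡[1+r]*[r*s] r s) (n∣m*n r))
    annihilate 3F = zeroʳ⇒∣* (r * s) refl

  skewColumn-∤ : ¬ m ∣ s * (r * s)
  skewColumn-∤ m∣s[rs] = [1+r]∤s (∣m+n∣m⇒∣n (subst (suc r ∣_) (+-comm s (r * s)) (m∣m*n s)) [1+r]∣rs)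
    where
    [1+r]∣rs : suc r ∣ r * s
    [1+r]∣rs = *-cancelˡ-∣ s (subst (_∣ s * (r * s)) m≡s*[1+r] m∣s[rs])

  skewColumn-≢ : s ≢ r * s
  skewColumn-≢ = <⇒≢ (subst (s <_) (*-comm s r) (m<m*n s r 2≤r))

¬chordal-≥4factors : ∀ {k} {n : Fin (4 + k) → ℕ} → (∀ i → 2 ≤ n i) → ¬ Chordal (4 + k) n
¬chordal-≥4factors {n = n} 2≤n =
  columns⇒¬chordal col (0F , >⇒∤ (2≤n 0F)) (1F , >⇒∤ (2≤n 1F)) (2F , λ ()) (3F , λ ())
  where
  0<n : ∀ i → 0 < n i
  0<n i = <-trans z<s (2≤n i)
  col : ∀ c → Column (n c)
  col 0F = evenColumn (2≤n 0F) (2≤n 0F)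
  col 1F = oddColumn (2≤n 1F) (2≤n 1F)
  col 2F = evenColumn (0<n 2F) (2≤n 2F)
  col 3F = oddColumn (0<n 3F) (2≤n 3F)
  col c@(Fin.suc (Fin.suc (Fin.suc (Fin.suc _)))) = evenColumn (0<n c) (0<n c)

¬chordal-3factors : ∀ {n : Fin 3 → ℕ} → (∀ i → 2 ≤ n i) → ∀ i → 3 ≤ n i → ¬ Chordal 3 n
¬chordal-3factors {n} 2≤n = square
  where
  wide : ∀ {c} → 3 ≤ n c → Column (n c)
  wide 3≤n = evenColumn (<⇒≤ 3≤n) 3≤n
  pair single : ∀ c → Column (n c)
  pair   c = oddColumn (2≤n c) (2≤n c)
  single c = oddColumn (2≤n c) (<-trans z<s (2≤n c))
  square : ∀ i → 3 ≤ n i → ¬ Chordal 3 n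
  square 0F 3≤n₀ = columns⇒¬chordal {n = n} (λ { 0F → wide 3≤n₀ ; 1F → pair 1F ; 2F → single 2F })
    (0F , >⇒∤ 3≤n₀) (1F , >⇒∤ (2≤n 1F)) (0F , λ ()) (2F , λ ())
  square 1F 3≤n₁ = columns⇒¬chordal {n = n} (λ { 0F → pair 0F ; 1F → wide 3≤n₁ ; 2F → single 2F })
    (1F , >⇒∤ 3≤n₁) (0F , >⇒∤ (2≤n 0F)) (1F , λ ()) (2F , λ ())
  square 2F 3≤n₂ = columns⇒¬chordal {n = n} (λ { 0F → pair 0F ; 1F → single 1F ; 2F → wide 3≤n₂ })
    (2F , >⇒∤ 3≤n₂) (0F , >⇒∤ (2≤n 0F)) (2F , λ ()) (1F , λ ())

¬chordal-ℤ≥3×ℤ≥3 : ∀ {n : Fin 2 → ℕ} → 3 ≤ n 0F → 3 ≤ n 1F → ¬ Chordal 2 n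
¬chordal-ℤ≥3×ℤ≥3 {n} 3≤n₀ 3≤n₁ =
  columns⇒¬chordal {n = n} (λ { 0F → evenColumn (<⇒≤ 3≤n₀) 3≤n₀ ; 1F → oddColumn (<⇒≤ 3≤n₁) 3≤n₁ })
    (0F , >⇒∤ 3≤n₀) (1F , >⇒∤ 3≤n₁) (0F , λ ()) (1F , λ ())

¬chordal-ℤ×skew : ∀ {n : Fin 2 → ℕ} → 2 ≤ n 0F → SkewFactorisation (n 1F) → ¬ Chordal 2 n
¬chordal-ℤ×skew {n} 2≤n₀ f =
  columns⇒¬chordal {n = n} (λ { 0F → evenColumn 2≤n₀ 2≤n₀ ; 1F → skewColumn f })
    (0F , >⇒∤ 2≤n₀) (1F , skewColumn-∤ f) (1F , λ ()) (1F , skewColumn-≢ f)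

¬chordal-skew×ℤ : ∀ {n : Fin 2 → ℕ} → SkewFactorisation (n 0F) → 2 ≤ n 1F → ¬ Chordal 2 n
¬chordal-skew×ℤ {n} f 2≤n₁ =
  columns⇒¬chordal {n = n} (λ { 0F → skewColumn f ; 1F → evenColumn 2≤n₁ 2≤n₁ })
    (1F , >⇒∤ 2≤n₁) (0F , skewColumn-∤ f) (0F , λ ()) (0F , skewColumn-≢ f)

-- Factoring a modulus

PrimeOrPrimeSquare : ℕ → Set
PrimeOrPrimeSquare m = ∃ λ p → Prime p × (m ≡ p ⊎ m ≡ p * p)

skew-p*2 : ∀ {p} → 3 ≤ p → SkewFactorisation (p * 2)
skew-p*2 {suc r} (s≤s 2≤r) = record
  { s = 2 ; r = r ; 2≤s = ≤-refl ; 2≤r = 2≤r ; m≡s*[1+r] = *-comm (suc r) 2 ; [1+r]∤s = >⇒∤ (s≤s 2≤r) }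

skew-p*q : ∀ {p} q → Prime p → suc (suc q) ≢ p → SkewFactorisation (p * suc (suc q))
skew-p*q {p} zero    p-prime 2≢p =
  skew-p*2 (≤∧≢⇒< (nonTrivial⇒n>1 p {{prime⇒nonTrivial p-prime}}) 2≢p)
skew-p*q {p} (suc r) p-prime q≢p = record
  { s = p ; r = suc (suc r) ; 2≤s = nonTrivial⇒n>1 p {{prime⇒nonTrivial p-prime}} ; 2≤r = s≤s (s≤s z≤n)
  ; m≡s*[1+r] = refl ; [1+r]∤s = q∤p }
  where
  q∤p : ¬ suc (suc (suc r)) ∣ p
  q∤p q∣p with prime⇒irreducible p-prime q∣p
  ... | inj₂ q≡p = q≢p q≡p

primeOrPrimeSquare⊎skew : ∀ m → 2 ≤ m → PrimeOrPrimeSquare m ⊎ SkewFactorisation m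
primeOrPrimeSquare⊎skew m 2≤m with factorise m {{>-nonZero (<-trans z<s 2≤m)}}
... | record { factors = [] ; isFactorisation = m≡1 } = ⊥-elim (<⇒≢ 2≤m (sym m≡1))
... | record { factors = p ∷ ps ; isFactorisation = m≡p*q ; factorsPrime = p-prime ∷ _ } =
  classify (product ps) m≡p*q
  where
  classify : ∀ q → m ≡ p * q → PrimeOrPrimeSquare m ⊎ SkewFactorisation m
  classify zero m≡p*0 = ⊥-elim (<⇒≢ (<-trans z<s 2≤m) (sym (trans m≡p*0 (*-zeroʳ p))))
  classify (suc zero) m≡p*1 = inj₁ (p , p-prime , inj₁ (trans m≡p*1 (*-identityʳ p)))
  classify q@(suc (suc q′)) m≡p*q with q ≟ p
  ... | yes refl = inj₁ (p , p-prime , inj₂ m≡p*q)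
  ... | no q≢p   = inj₂ (subst SkewFactorisation (sym m≡p*q) (skew-p*q q′ p-prime q≢p))

listed⇒chordal : ∀ k (n : Fin k → ℕ) → ListedRing k n → Chordal k n
listed⇒chordal 2 n (p , p-prime , inj₁ (n₀≡2 , n₁≡pᵉ)) = chordal-ℤ₂×ℤₚᵉ p-prime n₀≡2 n₁≡pᵉ
listed⇒chordal 2 n (p , p-prime , inj₂ (n₁≡2 , n₀≡pᵉ)) =
  chordal-reindex opposite (pointwise₂ (1F , refl) (0F , refl)) (chordal-ℤ₂×ℤₚᵉ p-prime n₁≡2 n₀≡pᵉ)
listed⇒chordal 3 n n≡2 = chordal-ℤ₂³ n≡2

chordal⇒listed₂ : ∀ (n : Fin 2 → ℕ) → (∀ i → 2 ≤ n i) → Chordal 2 n → ListedRing 2 n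
chordal⇒listed₂ n 2≤n chordal with n 0F ≟ 2 | n 1F ≟ 2
... | yes n₀≡2 | _ with primeOrPrimeSquare⊎skew (n 1F) (2≤n 1F)
...   | inj₁ (p , p-prime , n₁≡pᵉ) = p , p-prime , inj₁ (n₀≡2 , n₁≡pᵉ)
...   | inj₂ f = ⊥-elim (¬chordal-ℤ×skew (2≤n 0F) f chordal)
chordal⇒listed₂ n 2≤n chordal | no _ | yes n₁≡2 with primeOrPrimeSquare⊎skew (n 0F) (2≤n 0F)
...   | inj₁ (p , p-prime , n₀≡pᵉ) = p , p-prime , inj₂ (n₁≡2 , n₀≡pᵉ)
...   | inj₂ f = ⊥-elim (¬chordal-skew×ℤ f (2≤n 1F) chordal)
chordal⇒listed₂ n 2≤n chordal | no n₀≢2 | no n₁≢2 =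
  ⊥-elim (¬chordal-ℤ≥3×ℤ≥3 (≤∧≢⇒< (2≤n 0F) (n₀≢2 ∘ sym)) (≤∧≢⇒< (2≤n 1F) (n₁≢2 ∘ sym)) chordal)

chordal⇒listed₃ : ∀ (n : Fin 3 → ℕ) → (∀ i → 2 ≤ n i) → Chordal 3 n → ListedRing 3 n
chordal⇒listed₃ n 2≤n chordal i with n i ≟ 2
... | yes nᵢ≡2 = nᵢ≡2
... | no nᵢ≢2  = ⊥-elim (¬chordal-3factors 2≤n i (≤∧≢⇒< (2≤n i) (nᵢ≢2 ∘ sym)) chordal)

chordal⇒listed : ∀ k (n : Fin k → ℕ) → 2 ≤ k → (∀ i → 2 ≤ n i) → Chordal k n → ListedRing k n
chordal⇒listed 1 n (s≤s ())
chordal⇒listed 2 n _ = chordal⇒listed₂ n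
chordal⇒listed 3 n _ = chordal⇒listed₃ n
chordal⇒listed (suc (suc (suc (suc k)))) n _ 2≤n chordal = ¬chordal-≥4factors 2≤n chordal

theorem3p16 : (k : ℕ) → (n : Fin k → ℕ) → 2 ≤ k → (∀ i → 2 ≤ n i) →
                (Chordal k n ⇔ ListedRing k n)
theorem3p16 k n 2≤k 2≤n = mk⇔ (chordal⇒listed k n 2≤k 2≤n) (listed⇒chordal k n)
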